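{- For positive integers $m,n,s$, $${}_{s+1}F_s\left(\tfrac12,\ldots,\tfrac12,1-n;\tfrac32,\ldots,\tfrac32;1\right)=\sum_{k=1}^n(-1)^{k-1}\binom{n}{k}\sum_{j=0}^{k-1}\frac{1}{(2j+1)^s},$$ $${}_{s+1}F_s\left(\tfrac12,\ldots,\tfrac12,1-n;\tfrac32,\ldots,\tfrac32;-1\right)=\sum_{k=1}^n(-1)^{k-1}\binom{n}{k}\sum_{j=0}^{k-1}\frac{(-1)^j}{(2j+1)^s},$$ (where $\tfrac12$ and $\tfrac32$ each appear $s$ times) and $${}_2F_1(1,1-n;m+n;-1)=(m-1)!\,(m+n-1)\sum_{k=1}^n(-1)^{k-1}\binom{n}{k}G_{m,k},$$ where $G_{m,k}=\sum_{j=0}^{k-1}\frac{1}{(2j+1)(2j+2)\cdots(2j+m)}$.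
   Context: ${}_{s+1}F_s(a_1,\ldots,a_{s+1};b_1,\ldots,b_s;x)=\sum_{i\ge0}\frac{(a_1)_i\cdots(a_{s+1})_i}{(b_1)_i\cdots(b_s)_i}\frac{x^i}{i!}$, with $(a)_0=1$, $(a)_i=a(a+1)\cdots(a+i-1)$; with an upper parameter $1-n$ ($n$ a positive integer) the series terminates. -}

module Defs where

open import Data.Nat as ℕ using (ℕ; zero; suc)
open import Data.Nat.Combinatorics using (_C_)
open import Data.Nat.Base using (_!)
open import Data.Integer using (+_)
open import Data.List using (List; []; _∷_; replicate)
open import Data.Rational using (ℚ; 0ℚ; 1ℚ; _+_; _*_; _-_; -_; _÷_; _/_; ≢-nonZero)
open import Data.Rational.Properties using (_≟_)
open import Relation.Nullary using (yes; no)

⟦_⟧ : ℕ → ℚ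
⟦ n ⟧ = (+ n) / 1

_^_ : ℚ → ℕ → ℚ
x ^ zero  = 1ℚ
x ^ suc i = x * (x ^ i)

-- total division (value 0 when the divisor is 0; never used with a zero
-- divisor in the statement)
_//_ : ℚ → ℚ → ℚ
p // q with q ≟ 0ℚ
... | yes _  = 0ℚ
... | no q≢0 = _÷_ p q {{≢-nonZero q≢0}}

Σ< : ℕ → (ℕ → ℚ) → ℚ
Σ< zero    f = 0ℚ
Σ< (suc n) f = Σ< n f + f n

Σ[1‥_] : ℕ → (ℕ → ℚ) → ℚ
Σ[1‥ zero  ] f = 0ℚ
Σ[1‥ suc n ] f = Σ[1‥ n ] f + f (suc n)

Π[1‥_] : ℕ → (ℕ → ℚ) → ℚ
Π[1‥ zero  ] f = 1ℚ
Π[1‥ suc m ] f = Π[1‥ m ] f * f (suc m)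

poch : ℚ → ℕ → ℚ
poch a zero    = 1ℚ
poch a (suc i) = poch a i * (a + ⟦ i ⟧)

prodPoch : List ℚ → ℕ → ℚ
prodPoch []       i = 1ℚ
prodPoch (a ∷ as) i = poch a i * prodPoch as i

hypTerm : List ℚ → List ℚ → ℚ → ℕ → ℚ
hypTerm as bs x i = (prodPoch as i // prodPoch bs i) * ((x ^ i) // ⟦ (i !) ⟧)

hypPartial : List ℚ → List ℚ → ℚ → ℕ → ℚ
hypPartial as bs x N = Σ< N (hypTerm as bs x)

-- the series "equals" v: its partial sums are eventually equal to v
-- (for a terminating series, this is the value of the series)
open import Relation.Binary.PropositionalEquality using (_≡_)
open import Data.Product using (∃)
HypEq : List ℚ → List ℚ → ℚ → ℚ → Set
HypEq as bs x v = ∃ λ N₀ → ∀ N → N₀ ℕ.≤ N → hypPartial as bs x N ≡ v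

half threeHalves : ℚ
half = (+ 1) / 2
threeHalves = (+ 3) / 2

sgn : ℕ → ℚ
sgn k = (- 1ℚ) ^ k

G : ℕ → ℕ → ℚ
G m k = Σ< k (λ j → 1ℚ // Π[1‥ m ] (λ t → ⟦ 2 ℕ.* j ℕ.+ t ⟧))

-- For n = N + 1 the upper parameter 1 − n = −N gives (−N)_i = (−1)^i C(N,i) i!, so the
-- series terminate and, since (3/2)_i = (1/2)_i (2i+1), the first two are alternating
-- binomial sums Σ_j (−1)^j C(N,j) x^j / (2j+1)^s.  Pascal's rule turns any such sum of a
-- sequence a into Σ_{k=1}^{n} (−1)^(k−1) C(n,k) Σ_{j<k} a_j.
--
-- For the ₂F₁ put m = p + 1 and β p j = p! / ((2j+1)⋯(2j+p+1)) = ∫₀¹ t^(2j) (1−t)^p dt, so that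
-- J N p = Σ_j (−1)^j C(N,j) β p j = ∫₀¹ (1−t²)^N (1−t)^p dt.  Integration by parts gives
-- (p+N+2) J (N+1) p = 1 + (N+1) J N (p+2), which is the recursion in N satisfied by
-- ₂F₁(1, −N; p+N+2; −1) / (p+N+1).  Without integrals, the two facts used about them are
-- replaced by their discrete forms: β-rec (from t² = (1 − (1−t))²) and J-suc (from
-- (1−t²)(1−t)^p = 2(1−t)^(p+1) − (1−t)^(p+2)).

module Submission where

open import Defs
open import Data.Nat as ℕ using (ℕ; zero; suc; _≤_; _∸_)
import Data.Nat.Properties as ℕP
open import Data.Nat.Base using (_!)
open import Data.Nat.Combinatorics using (_C_; nC1≡n; k>n⇒nCk≡0; nCk+nC[k+1]≡[n+1]C[k+1])
open import Data.Nat.Tactic.RingSolver using (solve-∀)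
import Data.Integer as ℤ
import Data.Integer.Properties as ℤP
open import Data.Rational
  using (ℚ; 0ℚ; 1ℚ; _+_; _*_; _-_; -_; _<_; 1/_; mkℚ; ≢-nonZero) renaming (_≤_ to _≤ℚ_)
open import Data.Rational.Properties
open import Data.Rational.Solver
import Data.Nat.Coprimality as Coprime
open import Data.List using (List; []; _∷_; _++_; replicate)
open import Data.Product using (_×_; _,_)
open import Data.Sum using (inj₁; inj₂)
open import Relation.Binary.PropositionalEquality
  using (_≡_; _≢_; refl; sym; trans; cong; cong₂; subst; ≢-sym; module ≡-Reasoning)
open import Relation.Nullary using (yes; no; contradiction)

open +-*-Solver using (solve; _:=_; con; _:+_; _:*_; _:-_; :-_)
open ≡-Reasoning

⟦⟧≡mkℚ : ∀ n → ⟦ n ⟧ ≡ mkℚ (ℤ.+ n) 0 (Coprime.sym (Coprime.1-coprimeTo n))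
⟦⟧≡mkℚ n = normalize-coprime (Coprime.sym (Coprime.1-coprimeTo n))

⟦⟧-+ : ∀ m n → ⟦ m ℕ.+ n ⟧ ≡ ⟦ m ⟧ + ⟦ n ⟧
⟦⟧-+ m n = trans
  (/-cong (sym (cong₂ ℤ._+_ (ℤP.*-identityʳ (ℤ.+ m)) (ℤP.*-identityʳ (ℤ.+ n)))) refl)
  (sym (cong₂ _+_ (⟦⟧≡mkℚ m) (⟦⟧≡mkℚ n)))

⟦⟧-* : ∀ m n → ⟦ m ℕ.* n ⟧ ≡ ⟦ m ⟧ * ⟦ n ⟧
⟦⟧-* m n = trans (/-cong (ℤP.pos-* m n) refl) (sym (cong₂ _*_ (⟦⟧≡mkℚ m) (⟦⟧≡mkℚ n)))

0≤⟦⟧ : ∀ n → 0ℚ ≤ℚ ⟦ n ⟧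
0≤⟦⟧ n = nonNegative⁻¹ ⟦ n ⟧ {{normalize-nonNeg n 1}}

0<⟦suc⟧ : ∀ n → 0ℚ < ⟦ suc n ⟧
0<⟦suc⟧ n = positive⁻¹ ⟦ suc n ⟧ {{normalize-pos (suc n) 1}}

0<⇒≢0 : ∀ {p} → 0ℚ < p → p ≢ 0ℚ
0<⇒≢0 0<p = ≢-sym (<⇒≢ 0<p)

⟦⟧≢0 : ∀ {n} → 1 ≤ n → ⟦ n ⟧ ≢ 0ℚ
⟦⟧≢0 {suc n} _ = 0<⇒≢0 (0<⟦suc⟧ n)

p//q*q≡p : ∀ p {q} → q ≢ 0ℚ → (p // q) * q ≡ p
p//q*q≡p p {q} q≢0 with q ≟ 0ℚ
... | yes q≡0 = contradiction q≡0 q≢0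
... | no q≢0′ = begin
  p * (1/ q) * q   ≡⟨ *-assoc p _ q ⟩
  p * (1/ q * q)   ≡⟨ cong (p *_) (*-inverseˡ q) ⟩
  p * 1ℚ           ≡⟨ *-identityʳ p ⟩
  p                ∎
  where instance _ = ≢-nonZero q≢0′

*≡⇒//≡ : ∀ {p q r} → q ≢ 0ℚ → r * q ≡ p → p // q ≡ r
*≡⇒//≡ {q = q} {r} q≢0 refl with q ≟ 0ℚ
... | yes q≡0 = contradiction q≡0 q≢0
... | no q≢0′ = begin
  r * q * (1/ q)   ≡⟨ *-assoc r q _ ⟩
  r * (q * 1/ q)   ≡⟨ cong (r *_) (*-inverseʳ q) ⟩
  r * 1ℚ           ≡⟨ *-identityʳ r ⟩
  r                ∎
  where instance _ = ≢-nonZero q≢0′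

*-cancelʳ-≡ : ∀ {p q r} → r ≢ 0ℚ → p * r ≡ q * r → p ≡ q
*-cancelʳ-≡ r≢0 pr≡qr = trans (sym (*≡⇒//≡ r≢0 refl)) (*≡⇒//≡ r≢0 (sym pr≡qr))

*-≢0 : ∀ {p q} → p ≢ 0ℚ → q ≢ 0ℚ → p * q ≢ 0ℚ
*-≢0 {p} {q} p≢0 q≢0 pq≡0 = p≢0 (*-cancelʳ-≡ q≢0 (trans pq≡0 (sym (*-zeroˡ q))))

//-*-// : ∀ {a b c d} → b ≢ 0ℚ → d ≢ 0ℚ → (a // b) * (c // d) ≡ (a * c) // (b * d)
//-*-// {a} {b} {c} {d} b≢0 d≢0 = sym (*≡⇒//≡ (*-≢0 b≢0 d≢0) (begin
  (a // b) * (c // d) * (b * d)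
    ≡⟨ solve 4 (λ u b v d → u :* v :* (b :* d) := (u :* b) :* (v :* d)) refl (a // b) b (c // d) d ⟩
  ((a // b) * b) * ((c // d) * d)  ≡⟨ cong₂ _*_ (p//q*q≡p a b≢0) (p//q*q≡p c d≢0) ⟩
  a * c                            ∎))

//-*-cancelˡ : ∀ {p q r} → q ≢ 0ℚ → (p // q) * (q * r) ≡ p * r
//-*-cancelˡ {p} {q} {r} q≢0 = trans (sym (*-assoc (p // q) q r)) (cong (_* r) (p//q*q≡p p q≢0))

//-cancelˡ : ∀ {p q r} → r ≢ 0ℚ → q ≢ 0ℚ → (r * p) // (r * q) ≡ p // q
//-cancelˡ {p} {q} {r} r≢0 q≢0 = *≡⇒//≡ (*-≢0 r≢0 q≢0) (begin
  (p // q) * (r * q)  ≡⟨ solve 3 (λ u r q → u :* (r :* q) := r :* (u :* q)) refl (p // q) r q ⟩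
  r * ((p // q) * q)  ≡⟨ cong (r *_) (p//q*q≡p p q≢0) ⟩
  r * p               ∎)

*-//-assoc : ∀ p {q r} → r ≢ 0ℚ → (p * q) // r ≡ p * (q // r)
*-//-assoc p {q} {r} r≢0 = *≡⇒//≡ r≢0 (trans (*-assoc p (q // r) r) (cong (p *_) (p//q*q≡p q r≢0)))

Σ<-cong : ∀ n {f g : ℕ → ℚ} → (∀ i → f i ≡ g i) → Σ< n f ≡ Σ< n g
Σ<-cong zero    f≗g = refl
Σ<-cong (suc n) f≗g = cong₂ _+_ (Σ<-cong n f≗g) (f≗g n)

Σ<-+ : ∀ n (f g : ℕ → ℚ) → Σ< n (λ i → f i + g i) ≡ Σ< n f + Σ< n g
Σ<-+ zero    f g = refl
Σ<-+ (suc n) f g = trans (cong (_+ (f n + g n)) (Σ<-+ n f g))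
  (solve 4 (λ a b c d → (a :+ b) :+ (c :+ d) := (a :+ c) :+ (b :+ d)) refl (Σ< n f) (Σ< n g) (f n) (g n))

Σ<-* : ∀ n c (f : ℕ → ℚ) → Σ< n (λ i → c * f i) ≡ c * Σ< n f
Σ<-* zero    c f = sym (*-zeroʳ c)
Σ<-* (suc n) c f = trans (cong (_+ (c * f n)) (Σ<-* n c f)) (sym (*-distribˡ-+ c (Σ< n f) (f n)))

Σ<-suc : ∀ n (f : ℕ → ℚ) → Σ< (suc n) f ≡ f 0 + Σ< n (λ i → f (suc i))
Σ<-suc zero    f = trans (+-identityˡ (f 0)) (sym (+-identityʳ (f 0)))
Σ<-suc (suc n) f = trans (cong (_+ f (suc n)) (Σ<-suc n f)) (+-assoc (f 0) _ _)

Σ<-vanishing : ∀ {m n} (f : ℕ → ℚ) → (∀ i → m ≤ i → f i ≡ 0ℚ) → m ≤ n → Σ< n f ≡ Σ< m f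
Σ<-vanishing {m} f f≡0 m≤n with ℕP.m≤n⇒m<n∨m≡n m≤n
... | inj₂ refl = refl
... | inj₁ (ℕ.s≤s {n = n′} m≤n′) = begin
  Σ< n′ f + f n′   ≡⟨ cong₂ _+_ (Σ<-vanishing f f≡0 m≤n′) (f≡0 n′ m≤n′) ⟩
  Σ< m f + 0ℚ      ≡⟨ +-identityʳ (Σ< m f) ⟩
  Σ< m f           ∎

Σ[1‥]≡Σ< : ∀ n (f : ℕ → ℚ) → Σ[1‥ n ] f ≡ Σ< n (λ k → f (suc k))
Σ[1‥]≡Σ< zero    f = refl
Σ[1‥]≡Σ< (suc n) f = cong (_+ f (suc n)) (Σ[1‥]≡Σ< n f)

k>n⇒sgn*⟦nCk⟧*x≡0 : ∀ {n k} x → n ℕ.< k → sgn k * ⟦ n C k ⟧ * x ≡ 0ℚ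
k>n⇒sgn*⟦nCk⟧*x≡0 {n} {k} x n<k = begin
  sgn k * ⟦ n C k ⟧ * x  ≡⟨ cong (λ c → sgn k * ⟦ c ⟧ * x) (k>n⇒nCk≡0 n<k) ⟩
  sgn k * 0ℚ * x         ≡⟨ solve 2 (λ s x → s :* con 0ℚ :* x := con 0ℚ) refl (sgn k) x ⟩
  0ℚ                     ∎

altBinomSum : ℕ → (ℕ → ℚ) → ℚ
altBinomSum N f = Σ< (suc N) (λ j → sgn j * ⟦ N C j ⟧ * f j)

altBinomSum-cong : ∀ N {f g : ℕ → ℚ} → (∀ j → f j ≡ g j) → altBinomSum N f ≡ altBinomSum N g
altBinomSum-cong N f≗g = Σ<-cong (suc N) (λ j → cong (sgn j * ⟦ N C j ⟧ *_) (f≗g j))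

altBinomSum-+ : ∀ N (f g : ℕ → ℚ) →
  altBinomSum N (λ j → f j + g j) ≡ altBinomSum N f + altBinomSum N g
altBinomSum-+ N f g = trans
  (Σ<-cong (suc N) (λ j → *-distribˡ-+ (sgn j * ⟦ N C j ⟧) (f j) (g j)))
  (Σ<-+ (suc N) _ _)

altBinomSum-* : ∀ N c (f : ℕ → ℚ) → altBinomSum N (λ j → c * f j) ≡ c * altBinomSum N f
altBinomSum-* N c f = trans
  (Σ<-cong (suc N) (λ j → solve 4 (λ s b c f → s :* b :* (c :* f) := c :* (s :* b :* f)) refl
                                    (sgn j) ⟦ N C j ⟧ c (f j)))
  (Σ<-* (suc N) c _)

altBinomSum-pascal : ∀ N (f : ℕ → ℚ) →
  altBinomSum (suc N) f ≡ altBinomSum N f - altBinomSum N (λ j → f (suc j))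
altBinomSum-pascal N f = begin
  altBinomSum (suc N) f
    ≡⟨ Σ<-suc (suc N) _ ⟩
  g 0 + Σ< (suc N) (λ j → sgn (suc j) * ⟦ suc N C suc j ⟧ * f (suc j))
    ≡⟨ cong (g 0 +_) (Σ<-cong (suc N) split) ⟩
  g 0 + Σ< (suc N) (λ j → - 1ℚ * (sgn j * ⟦ N C j ⟧ * f (suc j)) + g (suc j))
    ≡⟨ cong (g 0 +_) (trans (Σ<-+ (suc N) _ _) (cong (_+ Σ< (suc N) (λ j → g (suc j))) (Σ<-* (suc N) (- 1ℚ) _))) ⟩
  g 0 + (- 1ℚ * altBinomSum N (λ j → f (suc j)) + (Σ< N (λ j → g (suc j)) + g (suc N)))
    ≡⟨ cong (λ z → g 0 + (- 1ℚ * altBinomSum N (λ j → f (suc j)) + (Σ< N (λ j → g (suc j)) + z)))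
            (k>n⇒sgn*⟦nCk⟧*x≡0 (f (suc N)) (ℕP.n<1+n N)) ⟩
  g 0 + (- 1ℚ * altBinomSum N (λ j → f (suc j)) + (Σ< N (λ j → g (suc j)) + 0ℚ))
    ≡⟨ solve 3 (λ a b c → a :+ (con (- 1ℚ) :* b :+ (c :+ con 0ℚ)) := (a :+ c) :- b) refl
               (g 0) (altBinomSum N (λ j → f (suc j))) (Σ< N (λ j → g (suc j))) ⟩
  (g 0 + Σ< N (λ j → g (suc j))) - altBinomSum N (λ j → f (suc j))
    ≡⟨ cong (_- altBinomSum N (λ j → f (suc j))) (sym (Σ<-suc N g)) ⟩
  altBinomSum N f - altBinomSum N (λ j → f (suc j)) ∎
  where
  g : ℕ → ℚ
  g j = sgn j * ⟦ N C j ⟧ * f j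
  split : ∀ j → sgn (suc j) * ⟦ suc N C suc j ⟧ * f (suc j)
              ≡ - 1ℚ * (sgn j * ⟦ N C j ⟧ * f (suc j)) + g (suc j)
  split j = begin
    sgn (suc j) * ⟦ suc N C suc j ⟧ * f (suc j)
      ≡⟨ cong (λ c → sgn (suc j) * c * f (suc j))
              (trans (cong ⟦_⟧ (sym (nCk+nC[k+1]≡[n+1]C[k+1] N j))) (⟦⟧-+ (N C j) (N C suc j))) ⟩
    - 1ℚ * sgn j * (⟦ N C j ⟧ + ⟦ N C suc j ⟧) * f (suc j)
      ≡⟨ solve 4 (λ s a b x → con (- 1ℚ) :* s :* (a :+ b) :* x
                              := con (- 1ℚ) :* (s :* a :* x) :+ con (- 1ℚ) :* s :* b :* x)
               refl (sgn j) ⟦ N C j ⟧ ⟦ N C suc j ⟧ (f (suc j)) ⟩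
    - 1ℚ * (sgn j * ⟦ N C j ⟧ * f (suc j)) + g (suc j) ∎

-- Multiplied by −1, both sides become altBinomSum (suc N) of the partial sums S: the left one
-- after peeling off the k = 0 term, the right one by Pascal's rule, as S (suc j) = S j + a j.
altBinomSum-partialSums : ∀ N (a : ℕ → ℚ) →
  Σ[1‥ suc N ] (λ k → sgn (k ∸ 1) * ⟦ suc N C k ⟧ * Σ< k a) ≡ altBinomSum N a
altBinomSum-partialSums N a = *-cancelʳ-≡ {r = - 1ℚ} (λ ()) (begin
  L * - 1ℚ
    ≡⟨ *-comm L (- 1ℚ) ⟩
  - 1ℚ * L
    ≡⟨ cong (- 1ℚ *_) (Σ[1‥]≡Σ< (suc N) _) ⟩
  - 1ℚ * Σ< (suc N) (λ k → sgn k * ⟦ suc N C suc k ⟧ * S (suc k))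
    ≡⟨ sym (Σ<-* (suc N) (- 1ℚ) _) ⟩
  Σ< (suc N) (λ k → - 1ℚ * (sgn k * ⟦ suc N C suc k ⟧ * S (suc k)))
    ≡⟨ Σ<-cong (suc N) (λ k → solve 3 (λ s c x → con (- 1ℚ) :* (s :* c :* x) := con (- 1ℚ) :* s :* c :* x)
                                      refl (sgn k) ⟦ suc N C suc k ⟧ (S (suc k))) ⟩
  Σ< (suc N) (λ k → sgn (suc k) * ⟦ suc N C suc k ⟧ * S (suc k))
    ≡⟨ sym (trans (Σ<-suc (suc N) _) (+-identityˡ _)) ⟩
  altBinomSum (suc N) S
    ≡⟨ altBinomSum-pascal N S ⟩
  altBinomSum N S - altBinomSum N (λ j → S j + a j)
    ≡⟨ cong (λ z → altBinomSum N S - z) (altBinomSum-+ N S a) ⟩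
  altBinomSum N S - (altBinomSum N S + altBinomSum N a)
    ≡⟨ solve 2 (λ s x → s :- (s :+ x) := x :* con (- 1ℚ)) refl (altBinomSum N S) (altBinomSum N a) ⟩
  altBinomSum N a * - 1ℚ ∎)
  where
  S : ℕ → ℚ
  S k = Σ< k a
  L : ℚ
  L = Σ[1‥ suc N ] (λ k → sgn (k ∸ 1) * ⟦ suc N C k ⟧ * S k)

^-distribʳ-* : ∀ a b s → (a * b) ^ s ≡ a ^ s * b ^ s
^-distribʳ-* a b zero    = refl
^-distribʳ-* a b (suc s) = trans (cong ((a * b) *_) (^-distribʳ-* a b s))
  (solve 4 (λ a b x y → (a :* b) :* (x :* y) := (a :* x) :* (b :* y)) refl a b (a ^ s) (b ^ s))

^-≢0 : ∀ {a} → a ≢ 0ℚ → ∀ s → a ^ s ≢ 0ℚ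
^-≢0 a≢0 zero    = 1≢0
^-≢0 a≢0 (suc s) = *-≢0 a≢0 (^-≢0 a≢0 s)

1^n≡1 : ∀ n → 1ℚ ^ n ≡ 1ℚ
1^n≡1 zero    = refl
1^n≡1 (suc n) = cong (1ℚ *_) (1^n≡1 n)

prodPoch-++ : ∀ as bs i → prodPoch (as ++ bs) i ≡ prodPoch as i * prodPoch bs i
prodPoch-++ []       bs i = sym (*-identityˡ (prodPoch bs i))
prodPoch-++ (a ∷ as) bs i = trans (cong (poch a i *_) (prodPoch-++ as bs i))
  (sym (*-assoc (poch a i) (prodPoch as i) (prodPoch bs i)))

prodPoch-replicate : ∀ s a i → prodPoch (replicate s a) i ≡ poch a i ^ s
prodPoch-replicate zero    a i = refl
prodPoch-replicate (suc s) a i = cong (poch a i *_) (prodPoch-replicate s a i)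

poch-suc : ∀ a i → poch a (suc i) ≡ a * poch (a + 1ℚ) i
poch-suc a zero    = solve 1 (λ a → con 1ℚ :* (a :+ con 0ℚ) := a :* con 1ℚ) refl a
poch-suc a (suc i) = begin
  poch a (suc i) * (a + ⟦ suc i ⟧)          ≡⟨ cong₂ _*_ (poch-suc a i) (cong (a +_) (⟦⟧-+ 1 i)) ⟩
  a * poch (a + 1ℚ) i * (a + (1ℚ + ⟦ i ⟧))
    ≡⟨ solve 3 (λ a p i → a :* p :* (a :+ (con 1ℚ :+ i)) := a :* (p :* ((a :+ con 1ℚ) :+ i)))
             refl a (poch (a + 1ℚ) i) ⟦ i ⟧ ⟩
  a * (poch (a + 1ℚ) i * ((a + 1ℚ) + ⟦ i ⟧)) ∎

poch-one : ∀ i → poch 1ℚ i ≡ ⟦ i ! ⟧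
poch-one zero    = refl
poch-one (suc i) = begin
  poch 1ℚ i * (1ℚ + ⟦ i ⟧)  ≡⟨ cong₂ _*_ (poch-one i) (sym (⟦⟧-+ 1 i)) ⟩
  ⟦ i ! ⟧ * ⟦ suc i ⟧       ≡⟨ *-comm ⟦ i ! ⟧ ⟦ suc i ⟧ ⟩
  ⟦ suc i ⟧ * ⟦ i ! ⟧       ≡⟨ sym (⟦⟧-* (suc i) (i !)) ⟩
  ⟦ suc i ! ⟧               ∎

poch-≢0 : ∀ {a} → 0ℚ < a → ∀ i → poch a i ≢ 0ℚ
poch-≢0 0<a zero    = 1≢0
poch-≢0 0<a (suc i) = *-≢0 (poch-≢0 0<a i) (0<⇒≢0 (+-mono-<-≤ 0<a (0≤⟦⟧ i)))

[1+k]*nC[1+k]+k*nCk≡n*nCk : ∀ n k → suc k ℕ.* (n C suc k) ℕ.+ k ℕ.* (n C k) ≡ n ℕ.* (n C k)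
[1+k]*nC[1+k]+k*nCk≡n*nCk zero    zero    = refl
[1+k]*nC[1+k]+k*nCk≡n*nCk zero    (suc k) = cong₂ ℕ._+_ (ℕP.*-zeroʳ (suc (suc k))) (ℕP.*-zeroʳ (suc k))
[1+k]*nC[1+k]+k*nCk≡n*nCk (suc n) zero    = trans (ℕP.+-identityʳ _)
  (trans (ℕP.*-identityˡ _) (trans (nC1≡n (suc n)) (sym (ℕP.*-identityʳ (suc n)))))
[1+k]*nC[1+k]+k*nCk≡n*nCk (suc n) (suc k) = begin
  suc (suc k) ℕ.* (suc n C suc (suc k)) ℕ.+ suc k ℕ.* (suc n C suc k)
    ≡⟨ cong₂ (λ x y → suc (suc k) ℕ.* x ℕ.+ suc k ℕ.* y)
             (sym (nCk+nC[k+1]≡[n+1]C[k+1] n (suc k))) (sym (nCk+nC[k+1]≡[n+1]C[k+1] n k)) ⟩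
  suc (suc k) ℕ.* (b ℕ.+ c) ℕ.+ suc k ℕ.* (a ℕ.+ b)
    ≡⟨ regroup k a b c ⟩
  (suc (suc k) ℕ.* c ℕ.+ suc k ℕ.* b) ℕ.+ (suc k ℕ.* b ℕ.+ k ℕ.* a) ℕ.+ a ℕ.+ b
    ≡⟨ cong₂ (λ x y → x ℕ.+ y ℕ.+ a ℕ.+ b)
             ([1+k]*nC[1+k]+k*nCk≡n*nCk n (suc k)) ([1+k]*nC[1+k]+k*nCk≡n*nCk n k) ⟩
  n ℕ.* b ℕ.+ n ℕ.* a ℕ.+ a ℕ.+ b
    ≡⟨ factor n a b ⟩
  suc n ℕ.* (a ℕ.+ b)
    ≡⟨ cong (suc n ℕ.*_) (nCk+nC[k+1]≡[n+1]C[k+1] n k) ⟩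
  suc n ℕ.* (suc n C suc k) ∎
  where
  a b c : ℕ
  a = n C k
  b = n C suc k
  c = n C suc (suc k)
  regroup : ∀ k a b c → suc (suc k) ℕ.* (b ℕ.+ c) ℕ.+ suc k ℕ.* (a ℕ.+ b)
    ≡ (suc (suc k) ℕ.* c ℕ.+ suc k ℕ.* b) ℕ.+ (suc k ℕ.* b ℕ.+ k ℕ.* a) ℕ.+ a ℕ.+ b
  regroup = solve-∀
  factor : ∀ n a b → n ℕ.* b ℕ.+ n ℕ.* a ℕ.+ a ℕ.+ b ≡ suc n ℕ.* (a ℕ.+ b)
  factor = solve-∀

poch-neg : ∀ N i → poch (- ⟦ N ⟧) i ≡ sgn i * (⟦ N C i ⟧ * ⟦ i ! ⟧)
poch-neg N zero    = refl
poch-neg N (suc i) = begin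
  poch (- n) i * (- n + ⟦ i ⟧)
    ≡⟨ cong (_* (- n + ⟦ i ⟧)) (poch-neg N i) ⟩
  sgn i * (c * ⟦ i ! ⟧) * (- n + ⟦ i ⟧)
    ≡⟨ solve 5 (λ s c f n i → s :* (c :* f) :* (:- n :+ i) := con (- 1ℚ) :* s :* ((c :* (n :- i)) :* f))
             refl (sgn i) c ⟦ i ! ⟧ n ⟦ i ⟧ ⟩
  - 1ℚ * sgn i * ((c * (n - ⟦ i ⟧)) * ⟦ i ! ⟧)
    ≡⟨ cong (λ z → - 1ℚ * sgn i * (z * ⟦ i ! ⟧)) (sym absorb) ⟩
  - 1ℚ * sgn i * ((c′ * ⟦ suc i ⟧) * ⟦ i ! ⟧)
    ≡⟨ cong (- 1ℚ * sgn i *_) (trans (*-assoc c′ ⟦ suc i ⟧ ⟦ i ! ⟧) (cong (c′ *_) (sym (⟦⟧-* (suc i) (i !))))) ⟩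
  sgn (suc i) * (c′ * ⟦ suc i ! ⟧) ∎
  where
  n = ⟦ N ⟧
  c = ⟦ N C i ⟧
  c′ = ⟦ N C suc i ⟧
  binomial : ⟦ suc i ⟧ * c′ + ⟦ i ⟧ * c ≡ n * c
  binomial = begin
    ⟦ suc i ⟧ * c′ + ⟦ i ⟧ * c
      ≡⟨ sym (cong₂ _+_ (⟦⟧-* (suc i) (N C suc i)) (⟦⟧-* i (N C i))) ⟩
    ⟦ suc i ℕ.* (N C suc i) ⟧ + ⟦ i ℕ.* (N C i) ⟧
      ≡⟨ sym (⟦⟧-+ (suc i ℕ.* (N C suc i)) (i ℕ.* (N C i))) ⟩
    ⟦ suc i ℕ.* (N C suc i) ℕ.+ i ℕ.* (N C i) ⟧
      ≡⟨ cong ⟦_⟧ ([1+k]*nC[1+k]+k*nCk≡n*nCk N i) ⟩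
    ⟦ N ℕ.* (N C i) ⟧
      ≡⟨ ⟦⟧-* N (N C i) ⟩
    n * c ∎
  absorb : c′ * ⟦ suc i ⟧ ≡ c * (n - ⟦ i ⟧)
  absorb = begin
    c′ * ⟦ suc i ⟧
      ≡⟨ solve 4 (λ c′ s i c → c′ :* s := (s :* c′ :+ i :* c) :- i :* c) refl c′ ⟦ suc i ⟧ ⟦ i ⟧ c ⟩
    (⟦ suc i ⟧ * c′ + ⟦ i ⟧ * c) - ⟦ i ⟧ * c
      ≡⟨ cong (_- ⟦ i ⟧ * c) binomial ⟩
    n * c - ⟦ i ⟧ * c
      ≡⟨ solve 3 (λ n i c → n :* c :- i :* c := c :* (n :- i)) refl n ⟦ i ⟧ c ⟩
    c * (n - ⟦ i ⟧) ∎

1-⟦suc⟧≡-⟦⟧ : ∀ N → 1ℚ - ⟦ suc N ⟧ ≡ - ⟦ N ⟧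
1-⟦suc⟧≡-⟦⟧ N = trans (cong (λ z → 1ℚ - z) (⟦⟧-+ 1 N))
  (solve 1 (λ n → con 1ℚ :- (con 1ℚ :+ n) := :- n) refl ⟦ N ⟧)

falling : ℕ → ℕ → ℚ
falling N i = sgn i * poch (- ⟦ N ⟧) i

falling-suc : ∀ N i → falling (suc N) (suc i) ≡ ⟦ suc N ⟧ * falling N i
falling-suc N i = begin
  sgn (suc i) * poch (- ⟦ suc N ⟧) (suc i)
    ≡⟨ cong (sgn (suc i) *_) (poch-suc (- ⟦ suc N ⟧) i) ⟩
  sgn (suc i) * (- ⟦ suc N ⟧ * poch (- ⟦ suc N ⟧ + 1ℚ) i)
    ≡⟨ cong (λ a → sgn (suc i) * (- ⟦ suc N ⟧ * poch a i)) (trans (+-comm (- ⟦ suc N ⟧) 1ℚ) (1-⟦suc⟧≡-⟦⟧ N)) ⟩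
  - 1ℚ * sgn i * (- ⟦ suc N ⟧ * poch (- ⟦ N ⟧) i)
    ≡⟨ solve 3 (λ s m p → con (- 1ℚ) :* s :* (:- m :* p) := m :* (s :* p)) refl (sgn i) ⟦ suc N ⟧ (poch (- ⟦ N ⟧) i) ⟩
  ⟦ suc N ⟧ * falling N i ∎

k>n⇒falling≡0 : ∀ {N i} → N ℕ.< i → falling N i ≡ 0ℚ
k>n⇒falling≡0 {N} {i} N<i = begin
  sgn i * poch (- ⟦ N ⟧) i                 ≡⟨ cong (sgn i *_) (poch-neg N i) ⟩
  sgn i * (sgn i * (⟦ N C i ⟧ * ⟦ i ! ⟧))  ≡⟨ cong (λ c → sgn i * (sgn i * (⟦ c ⟧ * ⟦ i ! ⟧))) (k>n⇒nCk≡0 N<i) ⟩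
  sgn i * (sgn i * (0ℚ * ⟦ i ! ⟧))         ≡⟨ solve 2 (λ s f → s :* (s :* (con 0ℚ :* f)) := con 0ℚ) refl (sgn i) ⟦ i ! ⟧ ⟩
  0ℚ                                       ∎

⟦2i+1⟧≡2⟦i⟧+1 : ∀ i → ⟦ 2 ℕ.* i ℕ.+ 1 ⟧ ≡ ⟦ 2 ⟧ * ⟦ i ⟧ + 1ℚ
⟦2i+1⟧≡2⟦i⟧+1 i = trans (⟦⟧-+ (2 ℕ.* i) 1) (cong (_+ 1ℚ) (⟦⟧-* 2 i))

poch-half : ∀ i → poch half i * ⟦ 2 ℕ.* i ℕ.+ 1 ⟧ ≡ poch threeHalves i
poch-half zero    = refl
poch-half (suc i) = begin
  poch half i * (half + ⟦ i ⟧) * ⟦ 2 ℕ.* suc i ℕ.+ 1 ⟧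
    ≡⟨ cong (poch half i * (half + ⟦ i ⟧) *_)
            (trans (⟦2i+1⟧≡2⟦i⟧+1 (suc i)) (cong (λ z → ⟦ 2 ⟧ * z + 1ℚ) (⟦⟧-+ 1 i))) ⟩
  poch half i * (half + ⟦ i ⟧) * (⟦ 2 ⟧ * (1ℚ + ⟦ i ⟧) + 1ℚ)
    ≡⟨ solve 2 (λ p i → p :* (con half :+ i) :* (con ⟦ 2 ⟧ :* (con 1ℚ :+ i) :+ con 1ℚ)
                      := p :* (con ⟦ 2 ⟧ :* i :+ con 1ℚ) :* (con threeHalves :+ i)) refl (poch half i) ⟦ i ⟧ ⟩
  poch half i * (⟦ 2 ⟧ * ⟦ i ⟧ + 1ℚ) * (threeHalves + ⟦ i ⟧)
    ≡⟨ cong (λ z → poch half i * z * (threeHalves + ⟦ i ⟧)) (sym (⟦2i+1⟧≡2⟦i⟧+1 i)) ⟩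
  poch half i * ⟦ 2 ℕ.* i ℕ.+ 1 ⟧ * (threeHalves + ⟦ i ⟧)
    ≡⟨ cong (_* (threeHalves + ⟦ i ⟧)) (poch-half i) ⟩
  poch threeHalves i * (threeHalves + ⟦ i ⟧) ∎

hypTerm-half : ∀ N s x i →
  hypTerm (replicate s half ++ (1ℚ - ⟦ suc N ⟧) ∷ []) (replicate s threeHalves) x i
    ≡ sgn i * ⟦ N C i ⟧ * ((x ^ i) // (⟦ 2 ℕ.* i ℕ.+ 1 ⟧ ^ s))
hypTerm-half N s x i = begin
  (prodPoch (replicate s half ++ (1ℚ - ⟦ suc N ⟧) ∷ []) i // prodPoch (replicate s threeHalves) i)
    * ((x ^ i) // I)
    ≡⟨ cong₂ (λ u v → (u // v) * ((x ^ i) // I)) numerator denominator ⟩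
  ((H * (sgn i * (c * I) * 1ℚ)) // (H * F)) * ((x ^ i) // I)
    ≡⟨ //-*-// (*-≢0 H≢0 F≢0) I≢0 ⟩
  ((H * (sgn i * (c * I) * 1ℚ)) * (x ^ i)) // ((H * F) * I)
    ≡⟨ cong₂ _//_
         (solve 5 (λ H s c I X → H :* (s :* (c :* I) :* con 1ℚ) :* X := H :* I :* (s :* c :* X))
                refl H (sgn i) c I (x ^ i))
         (solve 3 (λ H F I → H :* F :* I := H :* I :* F) refl H F I) ⟩
  ((H * I) * (sgn i * c * (x ^ i))) // ((H * I) * F)
    ≡⟨ //-cancelˡ (*-≢0 H≢0 I≢0) F≢0 ⟩
  (sgn i * c * (x ^ i)) // F
    ≡⟨ *-//-assoc (sgn i * c) F≢0 ⟩
  sgn i * c * ((x ^ i) // F) ∎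
  where
  H = poch half i ^ s
  F = ⟦ 2 ℕ.* i ℕ.+ 1 ⟧ ^ s
  I = ⟦ i ! ⟧
  c = ⟦ N C i ⟧
  H≢0 : H ≢ 0ℚ
  H≢0 = ^-≢0 (poch-≢0 (positive⁻¹ half) i) s
  F≢0 : F ≢ 0ℚ
  F≢0 = ^-≢0 (⟦⟧≢0 (ℕP.m≤n+m 1 (2 ℕ.* i))) s
  I≢0 : I ≢ 0ℚ
  I≢0 = ⟦⟧≢0 (ℕP.1≤n! i)
  numerator : prodPoch (replicate s half ++ (1ℚ - ⟦ suc N ⟧) ∷ []) i ≡ H * (sgn i * (c * I) * 1ℚ)
  numerator = begin
    prodPoch (replicate s half ++ (1ℚ - ⟦ suc N ⟧) ∷ []) i
      ≡⟨ prodPoch-++ (replicate s half) _ i ⟩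
    prodPoch (replicate s half) i * (poch (1ℚ - ⟦ suc N ⟧) i * 1ℚ)
      ≡⟨ cong₂ (λ u v → u * (poch v i * 1ℚ)) (prodPoch-replicate s half i) (1-⟦suc⟧≡-⟦⟧ N) ⟩
    H * (poch (- ⟦ N ⟧) i * 1ℚ)
      ≡⟨ cong (λ u → H * (u * 1ℚ)) (poch-neg N i) ⟩
    H * (sgn i * (c * I) * 1ℚ) ∎
  denominator : prodPoch (replicate s threeHalves) i ≡ H * F
  denominator = begin
    prodPoch (replicate s threeHalves) i        ≡⟨ prodPoch-replicate s threeHalves i ⟩
    poch threeHalves i ^ s                      ≡⟨ cong (_^ s) (sym (poch-half i)) ⟩
    (poch half i * ⟦ 2 ℕ.* i ℕ.+ 1 ⟧) ^ s       ≡⟨ ^-distribʳ-* _ _ s ⟩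
    H * F                                       ∎

hypTerm-2F1 : ∀ N {K} → 0ℚ < K → ∀ i →
  hypTerm (1ℚ ∷ (1ℚ - ⟦ suc N ⟧) ∷ []) (K ∷ []) (- 1ℚ) i ≡ falling N i // poch K i
hypTerm-2F1 N {K} 0<K i = begin
  ((poch 1ℚ i * (poch (1ℚ - ⟦ suc N ⟧) i * 1ℚ)) // (k * 1ℚ)) * (sgn i // I)
    ≡⟨ cong₂ (λ u v → ((u * (poch v i * 1ℚ)) // (k * 1ℚ)) * (sgn i // I)) (poch-one i) (1-⟦suc⟧≡-⟦⟧ N) ⟩
  ((I * (p * 1ℚ)) // (k * 1ℚ)) * (sgn i // I)
    ≡⟨ //-*-// (*-≢0 k≢0 1≢0) I≢0 ⟩
  ((I * (p * 1ℚ)) * sgn i) // ((k * 1ℚ) * I)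
    ≡⟨ cong₂ _//_ (solve 3 (λ I p s → I :* (p :* con 1ℚ) :* s := I :* (s :* p)) refl I p (sgn i))
                  (solve 2 (λ k I → k :* con 1ℚ :* I := I :* k) refl k I) ⟩
  (I * falling N i) // (I * k)
    ≡⟨ //-cancelˡ I≢0 k≢0 ⟩
  falling N i // k ∎
  where
  k = poch K i
  p = poch (- ⟦ N ⟧) i
  I = ⟦ i ! ⟧
  k≢0 : k ≢ 0ℚ
  k≢0 = poch-≢0 0<K i
  I≢0 : I ≢ 0ℚ
  I≢0 = ⟦⟧≢0 (ℕP.1≤n! i)

hypEq-terminating : ∀ as bs {x} (t : ℕ → ℚ) M →
  (∀ i → hypTerm as bs x i ≡ t i) → (∀ i → M ≤ i → t i ≡ 0ℚ) → HypEq as bs x (Σ< M t)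
hypEq-terminating as bs t M term≡t t≡0 = M , λ N M≤N → trans (Σ<-cong N term≡t) (Σ<-vanishing t t≡0 M≤N)

hypEq-half : ∀ N s x →
  HypEq (replicate s half ++ (1ℚ - ⟦ suc N ⟧) ∷ []) (replicate s threeHalves) x
    (altBinomSum N (λ j → (x ^ j) // (⟦ 2 ℕ.* j ℕ.+ 1 ⟧ ^ s)))
hypEq-half N s x =
  hypEq-terminating (replicate s half ++ (1ℚ - ⟦ suc N ⟧) ∷ []) (replicate s threeHalves) _ (suc N)
    (hypTerm-half N s x) (λ i N<i → k>n⇒sgn*⟦nCk⟧*x≡0 _ N<i)

hyp2F1 : ℚ → ℕ → ℚ
hyp2F1 K N = Σ< (suc N) (λ i → falling N i // poch K i)

hypEq-2F1 : ∀ N {K} → 0ℚ < K → HypEq (1ℚ ∷ (1ℚ - ⟦ suc N ⟧) ∷ []) (K ∷ []) (- 1ℚ) (hyp2F1 K N)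
hypEq-2F1 N {K} 0<K =
  hypEq-terminating (1ℚ ∷ (1ℚ - ⟦ suc N ⟧) ∷ []) (K ∷ []) _ (suc N) (hypTerm-2F1 N 0<K) λ i N<i →
  trans (cong (_// poch K i) (k>n⇒falling≡0 N<i)) (*≡⇒//≡ (poch-≢0 0<K i) (*-zeroˡ (poch K i)))

hyp2F1-suc : ∀ {K} → 0ℚ < K → ∀ N → hyp2F1 K (suc N) ≡ 1ℚ + (⟦ suc N ⟧ // K) * hyp2F1 (K + 1ℚ) N
hyp2F1-suc {K} 0<K N = begin
  hyp2F1 K (suc N)
    ≡⟨ Σ<-suc (suc N) _ ⟩
  1ℚ + Σ< (suc N) (λ i → falling (suc N) (suc i) // poch K (suc i))
    ≡⟨ cong (1ℚ +_) (Σ<-cong (suc N) term) ⟩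
  1ℚ + Σ< (suc N) (λ i → (⟦ suc N ⟧ // K) * (falling N i // poch (K + 1ℚ) i))
    ≡⟨ cong (1ℚ +_) (Σ<-* (suc N) (⟦ suc N ⟧ // K) _) ⟩
  1ℚ + (⟦ suc N ⟧ // K) * hyp2F1 (K + 1ℚ) N ∎
  where
  term : ∀ i → falling (suc N) (suc i) // poch K (suc i)
             ≡ (⟦ suc N ⟧ // K) * (falling N i // poch (K + 1ℚ) i)
  term i = begin
    falling (suc N) (suc i) // poch K (suc i)
      ≡⟨ cong₂ _//_ (falling-suc N i) (poch-suc K i) ⟩
    (⟦ suc N ⟧ * falling N i) // (K * poch (K + 1ℚ) i)
      ≡⟨ sym (//-*-// (0<⇒≢0 0<K) (poch-≢0 (+-mono-<-≤ 0<K (0≤⟦⟧ 1)) i)) ⟩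
    (⟦ suc N ⟧ // K) * (falling N i // poch (K + 1ℚ) i) ∎

blockProd : ℕ → ℕ → ℚ
blockProd m j = Π[1‥ m ] (λ t → ⟦ 2 ℕ.* j ℕ.+ t ⟧)

blockProd-≢0 : ∀ m j → blockProd m j ≢ 0ℚ
blockProd-≢0 zero    j = 1≢0
blockProd-≢0 (suc m) j = *-≢0 (blockProd-≢0 m j) (⟦⟧≢0 (ℕP.≤-trans (ℕ.s≤s ℕ.z≤n) (ℕP.m≤n+m (suc m) (2 ℕ.* j))))

blockProd-zero : ∀ m → blockProd m 0 ≡ ⟦ m ! ⟧
blockProd-zero zero    = refl
blockProd-zero (suc m) = begin
  blockProd m 0 * ⟦ suc m ⟧  ≡⟨ cong (_* ⟦ suc m ⟧) (blockProd-zero m) ⟩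
  ⟦ m ! ⟧ * ⟦ suc m ⟧        ≡⟨ *-comm ⟦ m ! ⟧ ⟦ suc m ⟧ ⟩
  ⟦ suc m ⟧ * ⟦ m ! ⟧        ≡⟨ sym (⟦⟧-* (suc m) (m !)) ⟩
  ⟦ suc m ! ⟧                ∎

blockProd-suc : ∀ m j →
  blockProd (suc (suc m)) j ≡ blockProd m (suc j) * (⟦ 2 ℕ.* j ℕ.+ 1 ⟧ * ⟦ 2 ℕ.* j ℕ.+ 2 ⟧)
blockProd-suc zero    j = *-assoc 1ℚ ⟦ 2 ℕ.* j ℕ.+ 1 ⟧ ⟦ 2 ℕ.* j ℕ.+ 2 ⟧
blockProd-suc (suc m) j = begin
  blockProd (suc (suc m)) j * ⟦ 2 ℕ.* j ℕ.+ suc (suc (suc m)) ⟧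
    ≡⟨ cong₂ _*_ (blockProd-suc m j) (cong ⟦_⟧ (shift j m)) ⟩
  blockProd m (suc j) * e * ⟦ 2 ℕ.* suc j ℕ.+ suc m ⟧
    ≡⟨ solve 3 (λ b e x → b :* e :* x := b :* x :* e) refl (blockProd m (suc j)) e ⟦ 2 ℕ.* suc j ℕ.+ suc m ⟧ ⟩
  blockProd (suc m) (suc j) * e ∎
  where
  e = ⟦ 2 ℕ.* j ℕ.+ 1 ⟧ * ⟦ 2 ℕ.* j ℕ.+ 2 ⟧
  shift : ∀ j m → 2 ℕ.* j ℕ.+ (3 ℕ.+ m) ≡ 2 ℕ.* (1 ℕ.+ j) ℕ.+ (1 ℕ.+ m)
  shift = solve-∀

β : ℕ → ℕ → ℚ
β p j = ⟦ p ! ⟧ // blockProd (suc p) j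

β-rec : ∀ p j → β p (suc j) + ⟦ 2 ⟧ * β (suc p) j ≡ β p j + β (suc (suc p)) j
β-rec p j = *-cancelʳ-≡ (blockProd-≢0 (3 ℕ.+ p) j) (begin
  (β p (suc j) + ⟦ 2 ⟧ * β (suc p) j) * Q
    ≡⟨ solve 3 (λ a b q → (a :+ con ⟦ 2 ⟧ :* b) :* q := a :* q :+ con ⟦ 2 ⟧ :* (b :* q)) refl
             (β p (suc j)) (β (suc p) j) Q ⟩
  β p (suc j) * Q + ⟦ 2 ⟧ * (β (suc p) j * Q)
    ≡⟨ cong₂ (λ u v → u + ⟦ 2 ⟧ * v)
             (trans (cong (β p (suc j) *_) (blockProd-suc (suc p) j)) (//-*-cancelˡ (blockProd-≢0 (suc p) (suc j))))
             (//-*-cancelˡ (blockProd-≢0 (2 ℕ.+ p) j)) ⟩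
  ⟦ p ! ⟧ * (e 1 * e 2) + ⟦ 2 ⟧ * (⟦ suc p ! ⟧ * e (3 ℕ.+ p))
    ≡⟨ sym (trans (⟦⟧-+ (p ! ℕ.* (o 1 ℕ.* o 2)) (2 ℕ.* (suc p ! ℕ.* o (3 ℕ.+ p))))
                  (cong₂ _+_ (⟦x*[y*z]⟧ (p !) (o 1) (o 2)) (⟦x*[y*z]⟧ 2 (suc p !) (o (3 ℕ.+ p))))) ⟩
  ⟦ p ! ℕ.* (o 1 ℕ.* o 2) ℕ.+ 2 ℕ.* (suc p ! ℕ.* o (3 ℕ.+ p)) ⟧
    ≡⟨ cong ⟦_⟧ (numerators (p !) j p) ⟩
  ⟦ p ! ℕ.* (o (2 ℕ.+ p) ℕ.* o (3 ℕ.+ p)) ℕ.+ suc (suc p) ! ⟧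
    ≡⟨ trans (⟦⟧-+ (p ! ℕ.* (o (2 ℕ.+ p) ℕ.* o (3 ℕ.+ p))) (suc (suc p) !))
             (cong (_+ ⟦ suc (suc p) ! ⟧) (⟦x*[y*z]⟧ (p !) (o (2 ℕ.+ p)) (o (3 ℕ.+ p)))) ⟩
  ⟦ p ! ⟧ * (e (2 ℕ.+ p) * e (3 ℕ.+ p)) + ⟦ suc (suc p) ! ⟧
    ≡⟨ cong₂ _+_
             (sym (trans (cong (β p j *_) (*-assoc (blockProd (suc p) j) _ _)) (//-*-cancelˡ (blockProd-≢0 (suc p) j))))
             (sym (p//q*q≡p ⟦ suc (suc p) ! ⟧ (blockProd-≢0 (3 ℕ.+ p) j))) ⟩
  β p j * Q + β (suc (suc p)) j * Q
    ≡⟨ sym (*-distribʳ-+ Q (β p j) (β (suc (suc p)) j)) ⟩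
  (β p j + β (suc (suc p)) j) * Q ∎)
  where
  Q = blockProd (3 ℕ.+ p) j
  o : ℕ → ℕ
  o t = 2 ℕ.* j ℕ.+ t
  e : ℕ → ℚ
  e t = ⟦ o t ⟧
  ⟦x*[y*z]⟧ : ∀ x y z → ⟦ x ℕ.* (y ℕ.* z) ⟧ ≡ ⟦ x ⟧ * (⟦ y ⟧ * ⟦ z ⟧)
  ⟦x*[y*z]⟧ x y z = trans (⟦⟧-* x (y ℕ.* z)) (cong (⟦ x ⟧ *_) (⟦⟧-* y z))
  numerators : ∀ F j p →
    F ℕ.* ((2 ℕ.* j ℕ.+ 1) ℕ.* (2 ℕ.* j ℕ.+ 2)) ℕ.+ 2 ℕ.* ((1 ℕ.+ p) ℕ.* F ℕ.* (2 ℕ.* j ℕ.+ (3 ℕ.+ p)))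
      ≡ F ℕ.* ((2 ℕ.* j ℕ.+ (2 ℕ.+ p)) ℕ.* (2 ℕ.* j ℕ.+ (3 ℕ.+ p))) ℕ.+ (2 ℕ.+ p) ℕ.* ((1 ℕ.+ p) ℕ.* F)
  numerators = solve-∀

J : ℕ → ℕ → ℚ
J N p = altBinomSum N (β p)

J-suc : ∀ N p → J (suc N) p ≡ ⟦ 2 ⟧ * J N (suc p) - J N (suc (suc p))
J-suc N p = begin
  J (suc N) p
    ≡⟨ altBinomSum-pascal N (β p) ⟩
  J N p - X
    ≡⟨ solve 3 (λ j x a → j :- x := j :+ con ⟦ 2 ⟧ :* a :- (x :+ con ⟦ 2 ⟧ :* a)) refl (J N p) X (J N (suc p)) ⟩
  J N p + ⟦ 2 ⟧ * J N (suc p) - (X + ⟦ 2 ⟧ * J N (suc p))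
    ≡⟨ cong (λ z → J N p + ⟦ 2 ⟧ * J N (suc p) - z) shifted ⟩
  J N p + ⟦ 2 ⟧ * J N (suc p) - (J N p + J N (suc (suc p)))
    ≡⟨ solve 3 (λ j a c → j :+ con ⟦ 2 ⟧ :* a :- (j :+ c) := con ⟦ 2 ⟧ :* a :- c) refl
             (J N p) (J N (suc p)) (J N (suc (suc p))) ⟩
  ⟦ 2 ⟧ * J N (suc p) - J N (suc (suc p)) ∎
  where
  X = altBinomSum N (λ j → β p (suc j))
  shifted : X + ⟦ 2 ⟧ * J N (suc p) ≡ J N p + J N (suc (suc p))
  shifted = begin
    X + ⟦ 2 ⟧ * J N (suc p)
      ≡⟨ sym (trans (altBinomSum-+ N _ _) (cong (X +_) (altBinomSum-* N ⟦ 2 ⟧ (β (suc p))))) ⟩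
    altBinomSum N (λ j → β p (suc j) + ⟦ 2 ⟧ * β (suc p) j)
      ≡⟨ altBinomSum-cong N (β-rec p) ⟩
    altBinomSum N (λ j → β p j + β (suc (suc p)) j)
      ≡⟨ altBinomSum-+ N (β p) (β (suc (suc p))) ⟩
    J N p + J N (suc (suc p)) ∎

J-zero : ∀ q → ⟦ suc q ⟧ * J 0 q ≡ 1ℚ
J-zero q = begin
  ⟦ suc q ⟧ * J 0 q
    ≡⟨ cong (⟦ suc q ⟧ *_) (solve 1 (λ b → con 0ℚ :+ con 1ℚ :* con 1ℚ :* b := b) refl (β q 0)) ⟩
  ⟦ suc q ⟧ * (⟦ q ! ⟧ // blockProd (suc q) 0)
    ≡⟨ sym (*-//-assoc ⟦ suc q ⟧ (blockProd-≢0 (suc q) 0)) ⟩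
  (⟦ suc q ⟧ * ⟦ q ! ⟧) // blockProd (suc q) 0
    ≡⟨ cong₂ _//_ (sym (⟦⟧-* (suc q) (q !))) (blockProd-zero (suc q)) ⟩
  ⟦ suc q ! ⟧ // ⟦ suc q ! ⟧
    ≡⟨ *≡⇒//≡ (⟦⟧≢0 (ℕP.1≤n! (suc q))) (*-identityˡ ⟦ suc q ! ⟧) ⟩
  1ℚ ∎

J-parts : ∀ N p → (⟦ p ⟧ + ⟦ N ⟧ + ⟦ 2 ⟧) * J (suc N) p ≡ 1ℚ + ⟦ suc N ⟧ * J N (suc (suc p))
J-parts zero p = begin
  (⟦ p ⟧ + ⟦ 0 ⟧ + ⟦ 2 ⟧) * J 1 p
    ≡⟨ cong ((⟦ p ⟧ + ⟦ 0 ⟧ + ⟦ 2 ⟧) *_) (J-suc 0 p) ⟩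
  (⟦ p ⟧ + ⟦ 0 ⟧ + ⟦ 2 ⟧) * (⟦ 2 ⟧ * a - b)
    ≡⟨ solve 3 (λ y a b → (y :+ con ⟦ 0 ⟧ :+ con ⟦ 2 ⟧) :* (con ⟦ 2 ⟧ :* a :- b)
                          := con ⟦ 2 ⟧ :* ((con ⟦ 2 ⟧ :+ y) :* a) :- (con ⟦ 3 ⟧ :+ y) :* b :+ b)
             refl ⟦ p ⟧ a b ⟩
  ⟦ 2 ⟧ * ((⟦ 2 ⟧ + ⟦ p ⟧) * a) - (⟦ 3 ⟧ + ⟦ p ⟧) * b + b
    ≡⟨ cong₂ (λ u v → ⟦ 2 ⟧ * u - v + b)
             (trans (cong (_* a) (sym (⟦⟧-+ 2 p))) (J-zero (suc p)))
             (trans (cong (_* b) (sym (⟦⟧-+ 3 p))) (J-zero (suc (suc p)))) ⟩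
  ⟦ 2 ⟧ * 1ℚ - 1ℚ + b
    ≡⟨ solve 1 (λ b → con ⟦ 2 ⟧ :* con 1ℚ :- con 1ℚ :+ b := con 1ℚ :+ con ⟦ 1 ⟧ :* b) refl b ⟩
  1ℚ + ⟦ 1 ⟧ * b ∎
  where
  a = J 0 (suc p)
  b = J 0 (suc (suc p))
J-parts (suc N) p = begin
  (y + ⟦ suc N ⟧ + ⟦ 2 ⟧) * J (suc (suc N)) p
    ≡⟨ cong₂ (λ m j → (y + m + ⟦ 2 ⟧) * j) (⟦⟧-+ 1 N) (J-suc (suc N) p) ⟩
  (y + (1ℚ + n) + ⟦ 2 ⟧) * (⟦ 2 ⟧ * a - b)
    ≡⟨ solve 4 (λ y n a b → (y :+ (con 1ℚ :+ n) :+ con ⟦ 2 ⟧) :* (con ⟦ 2 ⟧ :* a :- b)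
                            := con ⟦ 2 ⟧ :* ((con 1ℚ :+ y :+ n :+ con ⟦ 2 ⟧) :* a)
                               :- (con ⟦ 2 ⟧ :+ y :+ n :+ con ⟦ 2 ⟧) :* b :+ b)
             refl y n a b ⟩
  ⟦ 2 ⟧ * ((1ℚ + y + n + ⟦ 2 ⟧) * a) - (⟦ 2 ⟧ + y + n + ⟦ 2 ⟧) * b + b
    ≡⟨ cong₂ (λ u v → ⟦ 2 ⟧ * u - v + b)
             (trans (cong (λ z → (z + n + ⟦ 2 ⟧) * a) (sym (⟦⟧-+ 1 p))) (J-parts N (suc p)))
             (trans (cong (λ z → (z + n + ⟦ 2 ⟧) * b) (sym (⟦⟧-+ 2 p))) (J-parts N (suc (suc p)))) ⟩
  ⟦ 2 ⟧ * (1ℚ + ⟦ suc N ⟧ * c) - (1ℚ + ⟦ suc N ⟧ * d) + b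
    ≡⟨ solve 4 (λ m c d b → con ⟦ 2 ⟧ :* (con 1ℚ :+ m :* c) :- (con 1ℚ :+ m :* d) :+ b
                            := con 1ℚ :+ b :+ m :* (con ⟦ 2 ⟧ :* c :- d))
             refl ⟦ suc N ⟧ c d b ⟩
  1ℚ + b + ⟦ suc N ⟧ * (⟦ 2 ⟧ * c - d)
    ≡⟨ cong (λ z → 1ℚ + b + ⟦ suc N ⟧ * z) (sym (J-suc N (suc (suc p)))) ⟩
  1ℚ + b + ⟦ suc N ⟧ * b
    ≡⟨ cong (λ m → 1ℚ + b + m * b) (⟦⟧-+ 1 N) ⟩
  1ℚ + b + (1ℚ + n) * b
    ≡⟨ solve 2 (λ n b → con 1ℚ :+ b :+ (con 1ℚ :+ n) :* b := con 1ℚ :+ (con ⟦ 2 ⟧ :+ n) :* b) refl n b ⟩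
  1ℚ + (⟦ 2 ⟧ + n) * b
    ≡⟨ cong (λ m → 1ℚ + m * b) (sym (⟦⟧-+ 2 N)) ⟩
  1ℚ + ⟦ suc (suc N) ⟧ * b ∎
  where
  y = ⟦ p ⟧
  n = ⟦ N ⟧
  a = J (suc N) (suc p)
  b = J (suc N) (suc (suc p))
  c = J N (suc (suc (suc p)))
  d = J N (suc (suc (suc (suc p))))

hyp2F1≡J : ∀ N p → hyp2F1 (⟦ p ⟧ + ⟦ N ⟧ + ⟦ 2 ⟧) N ≡ (⟦ p ⟧ + ⟦ N ⟧ + 1ℚ) * J N p
hyp2F1≡J zero p = begin
  1ℚ                             ≡⟨ sym (J-zero p) ⟩
  ⟦ suc p ⟧ * J 0 p              ≡⟨ cong (_* J 0 p) (trans (⟦⟧-+ 1 p)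
                                     (solve 1 (λ y → con 1ℚ :+ y := y :+ con ⟦ 0 ⟧ :+ con 1ℚ) refl ⟦ p ⟧)) ⟩
  (⟦ p ⟧ + ⟦ 0 ⟧ + 1ℚ) * J 0 p   ∎
hyp2F1≡J (suc N) p = begin
  hyp2F1 K (suc N)
    ≡⟨ hyp2F1-suc 0<K N ⟩
  1ℚ + (⟦ suc N ⟧ // K) * hyp2F1 (K + 1ℚ) N
    ≡⟨ cong (λ z → 1ℚ + (⟦ suc N ⟧ // K) * hyp2F1 z N) K+1≡ ⟩
  1ℚ + (⟦ suc N ⟧ // K) * hyp2F1 (⟦ 2 ℕ.+ p ⟧ + n + ⟦ 2 ⟧) N
    ≡⟨ cong (λ z → 1ℚ + (⟦ suc N ⟧ // K) * z) (hyp2F1≡J N (2 ℕ.+ p)) ⟩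
  1ℚ + (⟦ suc N ⟧ // K) * ((⟦ 2 ℕ.+ p ⟧ + n + 1ℚ) * J N (suc (suc p)))
    ≡⟨ cong (λ z → 1ℚ + (⟦ suc N ⟧ // K) * (z * J N (suc (suc p)))) K≡ ⟩
  1ℚ + (⟦ suc N ⟧ // K) * (K * J N (suc (suc p)))
    ≡⟨ cong (1ℚ +_) (//-*-cancelˡ (0<⇒≢0 0<K)) ⟩
  1ℚ + ⟦ suc N ⟧ * J N (suc (suc p))
    ≡⟨ sym (J-parts N p) ⟩
  (y + n + ⟦ 2 ⟧) * J (suc N) p
    ≡⟨ cong (_* J (suc N) p) coefficient ⟩
  (y + ⟦ suc N ⟧ + 1ℚ) * J (suc N) p ∎
  where
  y = ⟦ p ⟧
  n = ⟦ N ⟧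
  K = y + ⟦ suc N ⟧ + ⟦ 2 ⟧
  0<K : 0ℚ < K
  0<K = +-mono-≤-< (+-mono-≤ (0≤⟦⟧ p) (0≤⟦⟧ (suc N))) (0<⟦suc⟧ 1)
  K+1≡ : K + 1ℚ ≡ ⟦ 2 ℕ.+ p ⟧ + n + ⟦ 2 ⟧
  K+1≡ = trans (cong (λ m → y + m + ⟦ 2 ⟧ + 1ℚ) (⟦⟧-+ 1 N))
    (trans (solve 2 (λ y n → y :+ (con 1ℚ :+ n) :+ con ⟦ 2 ⟧ :+ con 1ℚ := con ⟦ 2 ⟧ :+ y :+ n :+ con ⟦ 2 ⟧) refl y n)
           (cong (λ z → z + n + ⟦ 2 ⟧) (sym (⟦⟧-+ 2 p))))
  K≡ : ⟦ 2 ℕ.+ p ⟧ + n + 1ℚ ≡ K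
  K≡ = trans (cong (λ z → z + n + 1ℚ) (⟦⟧-+ 2 p))
    (trans (solve 2 (λ y n → con ⟦ 2 ⟧ :+ y :+ n :+ con 1ℚ := y :+ (con 1ℚ :+ n) :+ con ⟦ 2 ⟧) refl y n)
           (cong (λ m → y + m + ⟦ 2 ⟧) (sym (⟦⟧-+ 1 N))))
  coefficient : y + n + ⟦ 2 ⟧ ≡ y + ⟦ suc N ⟧ + 1ℚ
  coefficient = trans (solve 2 (λ y n → y :+ n :+ con ⟦ 2 ⟧ := y :+ (con 1ℚ :+ n) :+ con 1ℚ) refl y n)
    (cong (λ m → y + m + 1ℚ) (sym (⟦⟧-+ 1 N)))

hyp2F1-value : ∀ p N → hyp2F1 ⟦ suc p ℕ.+ suc N ⟧ N
  ≡ ⟦ p ! ⟧ * ⟦ p ℕ.+ suc N ⟧ * Σ[1‥ suc N ] (λ k → sgn (k ∸ 1) * ⟦ suc N C k ⟧ * G (suc p) k)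
hyp2F1-value p N = begin
  hyp2F1 ⟦ suc p ℕ.+ suc N ⟧ N
    ≡⟨ cong (λ K → hyp2F1 K N) parameter ⟩
  hyp2F1 (y + n + ⟦ 2 ⟧) N
    ≡⟨ hyp2F1≡J N p ⟩
  (y + n + 1ℚ) * J N p
    ≡⟨ cong₂ _*_ coefficient J≡ ⟩
  ⟦ p ℕ.+ suc N ⟧ * (⟦ p ! ⟧ * altBinomSum N g)
    ≡⟨ solve 3 (λ a f s → a :* (f :* s) := f :* a :* s) refl ⟦ p ℕ.+ suc N ⟧ ⟦ p ! ⟧ (altBinomSum N g) ⟩
  ⟦ p ! ⟧ * ⟦ p ℕ.+ suc N ⟧ * altBinomSum N g
    ≡⟨ cong (⟦ p ! ⟧ * ⟦ p ℕ.+ suc N ⟧ *_) (sym (altBinomSum-partialSums N g)) ⟩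
  ⟦ p ! ⟧ * ⟦ p ℕ.+ suc N ⟧ * Σ[1‥ suc N ] (λ k → sgn (k ∸ 1) * ⟦ suc N C k ⟧ * G (suc p) k) ∎
  where
  y = ⟦ p ⟧
  n = ⟦ N ⟧
  g : ℕ → ℚ
  g j = 1ℚ // blockProd (suc p) j
  J≡ : J N p ≡ ⟦ p ! ⟧ * altBinomSum N g
  J≡ = trans (altBinomSum-cong N (λ j → trans (cong (_// blockProd (suc p) j) (sym (*-identityʳ ⟦ p ! ⟧)))
                                              (*-//-assoc ⟦ p ! ⟧ (blockProd-≢0 (suc p) j))))
             (altBinomSum-* N ⟦ p ! ⟧ g)
  parameter : ⟦ suc p ℕ.+ suc N ⟧ ≡ y + n + ⟦ 2 ⟧
  parameter = trans (trans (⟦⟧-+ (suc p) (suc N)) (cong₂ _+_ (⟦⟧-+ 1 p) (⟦⟧-+ 1 N)))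
    (solve 2 (λ y n → con 1ℚ :+ y :+ (con 1ℚ :+ n) := y :+ n :+ con ⟦ 2 ⟧) refl y n)
  coefficient : y + n + 1ℚ ≡ ⟦ p ℕ.+ suc N ⟧
  coefficient = sym (trans (trans (⟦⟧-+ p (suc N)) (cong (y +_) (⟦⟧-+ 1 N)))
    (solve 2 (λ y n → y :+ (con 1ℚ :+ n) := y :+ n :+ con 1ℚ) refl y n))

corollary3p6 : (m n s : ℕ) → 1 ≤ m → 1 ≤ n → 1 ≤ s →
    HypEq (replicate s half ++ (1ℚ - ⟦ n ⟧) ∷ []) (replicate s threeHalves) 1ℚ
      (Σ[1‥ n ] (λ k → sgn (k ∸ 1) * ⟦ n C k ⟧
        * Σ< k (λ j → 1ℚ // (⟦ 2 ℕ.* j ℕ.+ 1 ⟧ ^ s))))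
    × HypEq (replicate s half ++ (1ℚ - ⟦ n ⟧) ∷ []) (replicate s threeHalves) (- 1ℚ)
      (Σ[1‥ n ] (λ k → sgn (k ∸ 1) * ⟦ n C k ⟧
        * Σ< k (λ j → sgn j // (⟦ 2 ℕ.* j ℕ.+ 1 ⟧ ^ s))))
    × HypEq (1ℚ ∷ (1ℚ - ⟦ n ⟧) ∷ []) (⟦ m ℕ.+ n ⟧ ∷ []) (- 1ℚ)
      (⟦ (m ∸ 1) ! ⟧ * ⟦ m ℕ.+ n ∸ 1 ⟧
        * Σ[1‥ n ] (λ k → sgn (k ∸ 1) * ⟦ n C k ⟧ * G m k))
corollary3p6 (suc p) (suc N) s _ _ _ =
    subst (HypEq as bs 1ℚ)
      (trans (altBinomSum-cong N (λ j → cong (_// (⟦ 2 ℕ.* j ℕ.+ 1 ⟧ ^ s)) (1^n≡1 j)))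
             (sym (altBinomSum-partialSums N _)))
      (hypEq-half N s 1ℚ)
  , subst (HypEq as bs (- 1ℚ)) (sym (altBinomSum-partialSums N _)) (hypEq-half N s (- 1ℚ))
  , subst (HypEq (1ℚ ∷ (1ℚ - ⟦ suc N ⟧) ∷ []) (⟦ suc p ℕ.+ suc N ⟧ ∷ []) (- 1ℚ))
      (hyp2F1-value p N) (hypEq-2F1 N (0<⟦suc⟧ (p ℕ.+ suc N)))
  where
  as bs : List ℚ
  as = replicate s half ++ (1ℚ - ⟦ suc N ⟧) ∷ []
  bs = replicate s threeHalves
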